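{- Let $s$ be a positive integer, let $\rho=(\rho_1,\dots,\rho_m)$, $m\ge1$, be a sequence of integers between $1$ and $s-1$, and fix a positive integer $\gamma_m$. For a strictly increasing sequence $\gamma=(\gamma_1,\dots,\gamma_m)$ of positive integers define $\mathbf d(\rho,\gamma)=(d_1,\dots,d_m)$ by $d_j=0$ if $j>1$, $\rho_{j-1}\ge\rho_j$ and $\gamma_j=\gamma_{j-1}+1$, and $d_j=1$ otherwise. Then, with $Q$ an indeterminate, $$\sum_{1\le\gamma_1<\dots<\gamma_{m-1}<\gamma_m}Q^{\sum_{j=1}^m d_j(\gamma_j-1)}=Q^{ -\mathrm{wmaj}(\rho)}\sum_{1\le\gamma_1<\dots<\gamma_{m-1}<\gamma_m}Q^{|\gamma|-m},$$ where both sums run over $\gamma_1,\dots,\gamma_{m-1}$ with $\gamma_m$ fixed, and $|\gamma|=\gamma_1+\dots+\gamma_m$.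
   Context: $\mathrm{wmaj}(\rho)=\sum_{j:\,1\le j<m,\ \rho_j\ge\rho_{j+1}}j$ (the sum of positions of weak descents of $\rho$). -}

module Defs where

open import Data.Nat using (ℕ; zero; suc; _+_; _*_; _∸_; _≤?_; _≟_)
open import Data.Bool using (Bool; true; false; if_then_else_; _∧_)
open import Data.List using (List; []; _∷_; _∷ʳ_; _++_; map)
open import Relation.Nullary.Decidable using (⌊_⌋)

-- incSeqs k b : the list of all strictly increasing sequences
-- (γ₁ < … < γ_k) with entries in {1, …, b}, each listed exactly once.
-- (Either the last entry is ≤ b, or it equals b+1.)
incSeqs : ℕ → ℕ → List (List ℕ)
incSeqs zero    b       = [] ∷ []
incSeqs (suc k) zero    = []
incSeqs (suc k) (suc b) = incSeqs (suc k) b ++ map (_∷ʳ suc b) (incSeqs k b)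

dEntry : ℕ → ℕ → ℕ → ℕ → ℕ
dEntry rprev gprev r g =
  if ⌊ r ≤? rprev ⌋ ∧ ⌊ g ≟ suc gprev ⌋ then 0 else 1

dTail : ℕ → ℕ → List ℕ → List ℕ → ℕ
dTail rp gp (r ∷ rs) (g ∷ gs) = dEntry rp gp r g * (g ∸ 1) + dTail r g rs gs
dTail rp gp _        _        = 0

dExp : List ℕ → List ℕ → ℕ
dExp (r ∷ rs) (g ∷ gs) = (g ∸ 1) + dTail r g rs gs
dExp _        _        = 0

wmajFrom : ℕ → List ℕ → ℕ
wmajFrom i (r ∷ r' ∷ rs) = (if ⌊ r' ≤? r ⌋ then i else 0) + wmajFrom (suc i) (r' ∷ rs)
wmajFrom i _             = 0

wmaj : List ℕ → ℕ
wmaj = wmajFrom 1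

{-# OPTIONS --safe #-}
-- Let G k b be the multiset of the sums |γ| over k-subsets γ of {1, …, b}. Removing the largest
-- element of γ gives G (k+1) (b+1) = G (k+1) b ∪ (G k b + (b+1)); removing the smallest gives
-- G (k+1) (b+1) = (G (k+1) b ∪ G k b) + (k+1).
-- With e(γ) = Σ_j d_j (γ_j - 1), the claim says that e(γ) + wmaj ρ + m and |γ| have the same
-- multiset of values. Induct on ρ from the right and split the sum according to
-- γ_{m-1} = c+1 < γ_m = b+1. If ρ_{m-1} < ρ_m, then d_m = 1 and wmaj does not
-- change, so each block is shifted by b+1 and the first recursion reassembles them. If
-- ρ_{m-1} ≥ ρ_m, then wmaj grows by m-1 and d_m = 0 exactly on the block c = b-1: the blocks c < b-1
-- reassemble to G (m-1) (b-1), the last block is G (m-2) (b-1), both carry the same shift, and the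
-- second recursion finishes the step.
module Submission where

open import Defs
open import Data.Bool using (if_then_else_)
open import Data.Integer using (ℤ; +_; _-_; _⊖_)
open import Data.Integer.Properties using ([+m]-[+n]≡m⊖n; ⊖-≥)
open import Data.List using (List; []; _∷_; [_]; _++_; map; length; _∷ʳ_; initLast; _∷ʳ′_)
open import Data.List.Properties using (map-++; map-∘; map-cong; map-cong-local; length-++; ++-assoc)
open import Data.List.Relation.Unary.All using (All; []; _∷_)
import Data.List.Relation.Unary.All as All
import Data.List.Relation.Unary.All.Properties as All
open import Data.List.Relation.Binary.Permutation.Propositional
  using (_↭_; ↭-refl; ↭-reflexive; ↭-sym; module PermutationReasoning)
open import Data.List.Relation.Binary.Permutation.Propositional.Properties
  using (++⁺; ++⁺ˡ; ++⁺ʳ; shifts; map⁺)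
open import Data.Nat using (ℕ; zero; suc; _+_; _*_; _∸_; _≤_; _<_; _≤?_; _≟_; s≤s)
open import Data.Nat.ListAction using (sum)
open import Data.Nat.ListAction.Properties using (sum-++)
open import Data.Nat.Properties
  using (+-identityʳ; +-assoc; +-comm; +-suc; suc-injective; ≤-refl; m<n⇒m<1+n; >⇒≢; m≤n+m; m+n∸n≡m)
open import Data.Nat.Tactic.RingSolver using (solve-∀)
open import Data.Product using (_×_)
open import Function using (_∘_)
open import Relation.Binary.PropositionalEquality
  using (_≡_; _≢_; refl; sym; trans; cong; cong₂; module ≡-Reasoning)
open import Relation.Nullary using (¬_; yes; no; contradiction)
open import Relation.Nullary.Decidable using (⌊_⌋)

sum-∷ʳ : ∀ xs x → sum (xs ∷ʳ x) ≡ sum xs + x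
sum-∷ʳ xs x = trans (sum-++ xs [ x ]) (cong (λ t → sum xs + t) (+-identityʳ x))

length-∷ʳ : ∀ {A : Set} (xs : List A) x → length (xs ∷ʳ x) ≡ suc (length xs)
length-∷ʳ xs x = trans (length-++ xs) (+-comm (length xs) 1)

length-init : ∀ {A : Set} (xs : List A) {x n} → length (xs ∷ʳ x) ≡ suc n → length xs ≡ n
length-init xs {x} |xs∷ʳx|≡1+n = suc-injective (trans (sym (length-∷ʳ xs x)) |xs∷ʳx|≡1+n)

+[m+n]-+n≡+m : ∀ m n → + (m + n) - + n ≡ + m
+[m+n]-+n≡+m m n = begin
  + (m + n) - + n  ≡⟨ [+m]-[+n]≡m⊖n (m + n) n ⟩
  (m + n) ⊖ n      ≡⟨ ⊖-≥ (m≤n+m n m) ⟩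
  + (m + n ∸ n)    ≡⟨ cong +_ (m+n∸n≡m m n) ⟩
  + m              ∎
  where open ≡-Reasoning

incSeqs-length : ∀ k b → All (λ γ → length γ ≡ k) (incSeqs k b)
incSeqs-length zero    b       = refl ∷ []
incSeqs-length (suc k) zero    = []
incSeqs-length (suc k) (suc b) =
  All.++⁺ (incSeqs-length (suc k) b)
          (All.map⁺ (All.map (λ {γ} |γ|≡k → trans (length-∷ʳ γ (suc b)) (cong suc |γ|≡k))
                             (incSeqs-length k b)))

map-incSeqs-suc : ∀ {A : Set} (f : List ℕ → A) k b →
  map f (incSeqs (suc k) (suc b))
    ≡ map f (incSeqs (suc k) b) ++ map (λ γ → f (γ ∷ʳ suc b)) (incSeqs k b)
map-incSeqs-suc f k b =
  trans (map-++ f (incSeqs (suc k) b) _) (cong (map f (incSeqs (suc k) b) ++_) (sym (map-∘ (incSeqs k b))))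

subsetSums : ℕ → ℕ → ℕ → List ℕ
subsetSums k b a = map (λ γ → sum γ + a) (incSeqs k b)

subsetSums-suc : ∀ k b a →
  subsetSums (suc k) (suc b) a ≡ subsetSums (suc k) b a ++ subsetSums k b (suc b + a)
subsetSums-suc k b a =
  trans (map-incSeqs-suc (λ γ → sum γ + a) k b)
        (cong (subsetSums (suc k) b a ++_) (map-cong sum-∷ʳ+a (incSeqs k b)))
  where
  sum-∷ʳ+a : ∀ γ → sum (γ ∷ʳ suc b) + a ≡ sum γ + (suc b + a)
  sum-∷ʳ+a γ = trans (cong (_+ a) (sum-∷ʳ γ (suc b))) (+-assoc (sum γ) (suc b) a)

subsetSums-blocks : ∀ {k b a} (f : List ℕ → ℕ) →
  (∀ c → c < b → map (λ γ → f (γ ∷ʳ suc c)) (incSeqs k c) ↭ subsetSums k c (suc c + a)) →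
  map f (incSeqs (suc k) b) ↭ subsetSums (suc k) b a
subsetSums-blocks {b = zero}      f blocks = ↭-refl
subsetSums-blocks {k} {suc b} {a} f blocks = begin
  map f (incSeqs (suc k) (suc b))
    ≡⟨ map-incSeqs-suc f k b ⟩
  map f (incSeqs (suc k) b) ++ map (λ γ → f (γ ∷ʳ suc b)) (incSeqs k b)
    ↭⟨ ++⁺ (subsetSums-blocks f (λ c c<b → blocks c (m<n⇒m<1+n c<b))) (blocks b ≤-refl) ⟩
  subsetSums (suc k) b a ++ subsetSums k b (suc b + a)
    ≡⟨ sym (subsetSums-suc k b a) ⟩
  subsetSums (suc k) (suc b) a ∎
  where open PermutationReasoning

++-interchange : ∀ {A : Set} (ws xs ys zs : List A) → (ws ++ xs) ++ (ys ++ zs) ↭ (ws ++ ys) ++ (xs ++ zs)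
++-interchange ws xs ys zs = begin
  (ws ++ xs) ++ (ys ++ zs)  ≡⟨ ++-assoc ws xs (ys ++ zs) ⟩
  ws ++ (xs ++ ys ++ zs)    ↭⟨ ++⁺ˡ ws (shifts xs ys) ⟩
  ws ++ (ys ++ xs ++ zs)    ≡⟨ sym (++-assoc ws ys (xs ++ zs)) ⟩
  (ws ++ ys) ++ (xs ++ zs)  ∎
  where open PermutationReasoning

subsetSums-pascal : ∀ k b a →
  subsetSums (suc k) (suc b) a ↭ subsetSums (suc k) b (suc k + a) ++ subsetSums k b (suc k + a)
subsetSums-pascal zero    zero    a = ↭-refl
subsetSums-pascal (suc k) zero    a = ↭-refl
subsetSums-pascal zero    (suc b) a = begin
  subsetSums 1 (suc (suc b)) a
    ≡⟨ subsetSums-suc 0 (suc b) a ⟩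
  subsetSums 1 (suc b) a ++ [ suc (suc b) + a ]
    ↭⟨ ++⁺ʳ _ (subsetSums-pascal 0 b a) ⟩
  (subsetSums 1 b (suc a) ++ [ suc a ]) ++ [ suc (suc b) + a ]
    ↭⟨ ++-interchange (subsetSums 1 b (suc a)) [ suc a ] [ suc (suc b) + a ] [] ⟩
  (subsetSums 1 b (suc a) ++ [ suc (suc b) + a ]) ++ [ suc a ]
    ≡⟨ cong (λ t → (subsetSums 1 b (suc a) ++ [ t ]) ++ [ suc a ]) (offset b a) ⟩
  (subsetSums 1 b (suc a) ++ [ suc b + suc a ]) ++ [ suc a ]
    ≡⟨ cong (_++ [ suc a ]) (sym (subsetSums-suc 0 b (suc a))) ⟩
  subsetSums 1 (suc b) (suc a) ++ [ suc a ] ∎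
  where
  open PermutationReasoning
  offset : ∀ b a → suc (suc b) + a ≡ suc b + suc a
  offset = solve-∀
subsetSums-pascal (suc k) (suc b) a = begin
  subsetSums (suc (suc k)) (suc (suc b)) a
    ≡⟨ subsetSums-suc (suc k) (suc b) a ⟩
  subsetSums (suc (suc k)) (suc b) a ++ subsetSums (suc k) (suc b) (suc (suc b) + a)
    ↭⟨ ++⁺ (subsetSums-pascal (suc k) b a) (subsetSums-pascal k b (suc (suc b) + a)) ⟩
  (subsetSums (suc (suc k)) b a′ ++ subsetSums (suc k) b a′)
    ++ (subsetSums (suc k) b (suc k + (suc (suc b) + a)) ++ subsetSums k b (suc k + (suc (suc b) + a)))
    ↭⟨ ++-interchange (subsetSums (suc (suc k)) b a′) _ _ _ ⟩
  (subsetSums (suc (suc k)) b a′ ++ subsetSums (suc k) b (suc k + (suc (suc b) + a)))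
    ++ (subsetSums (suc k) b a′ ++ subsetSums k b (suc k + (suc (suc b) + a)))
    ≡⟨ cong (λ t → (subsetSums (suc (suc k)) b a′ ++ subsetSums (suc k) b t)
                     ++ (subsetSums (suc k) b a′ ++ subsetSums k b t)) (offset k b a) ⟩
  (subsetSums (suc (suc k)) b a′ ++ subsetSums (suc k) b (suc b + a′))
    ++ (subsetSums (suc k) b a′ ++ subsetSums k b (suc b + a′))
    ≡⟨ sym (cong₂ _++_ (subsetSums-suc (suc k) b a′) (subsetSums-suc k b a′)) ⟩
  subsetSums (suc (suc k)) (suc b) a′ ++ subsetSums (suc k) (suc b) a′ ∎
  where
  open PermutationReasoning
  a′ = suc (suc k) + a
  offset : ∀ k b a → suc k + (suc (suc b) + a) ≡ suc b + (suc (suc k) + a)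
  offset = solve-∀

dTail-∷ʳ : ∀ r₀ g₀ ρ γ {p c r g} → length ρ ≡ length γ →
  dTail r₀ g₀ (ρ ∷ʳ p ∷ʳ r) (γ ∷ʳ c ∷ʳ g)
    ≡ dTail r₀ g₀ (ρ ∷ʳ p) (γ ∷ʳ c) + dEntry p c r g * (g ∸ 1)
dTail-∷ʳ r₀ g₀ []      []      {p} {c} {r} {g} _ =
  cong₂ _+_ (sym (+-identityʳ (dEntry r₀ g₀ p c * (c ∸ 1)))) (+-identityʳ (dEntry p c r g * (g ∸ 1)))
dTail-∷ʳ r₀ g₀ (x ∷ ρ) (y ∷ γ) |ρ|≡|γ| =
  trans (cong (λ t → dEntry r₀ g₀ x y * (y ∸ 1) + t) (dTail-∷ʳ x y ρ γ (suc-injective |ρ|≡|γ|)))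
        (sym (+-assoc (dEntry r₀ g₀ x y * (y ∸ 1)) _ _))

dExp-∷ʳ : ∀ ρ γ {p c r g} → length ρ ≡ length γ →
  dExp (ρ ∷ʳ p ∷ʳ r) (γ ∷ʳ c ∷ʳ g) ≡ dExp (ρ ∷ʳ p) (γ ∷ʳ c) + dEntry p c r g * (g ∸ 1)
dExp-∷ʳ []      []      {p} {c} {r} {g} _ =
  cong₂ _+_ (sym (+-identityʳ (c ∸ 1))) (+-identityʳ (dEntry p c r g * (g ∸ 1)))
dExp-∷ʳ (x ∷ ρ) (y ∷ γ) |ρ|≡|γ| =
  trans (cong (λ t → (y ∸ 1) + t) (dTail-∷ʳ x y ρ γ (suc-injective |ρ|≡|γ|)))
        (sym (+-assoc (y ∸ 1) _ _))

wmajFrom-∷ʳ : ∀ i ρ p r →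
  wmajFrom i (ρ ∷ʳ p ∷ʳ r) ≡ wmajFrom i (ρ ∷ʳ p) + wmajFrom (i + length ρ) (p ∷ r ∷ [])
wmajFrom-∷ʳ i []          p r = cong (λ j → wmajFrom j (p ∷ r ∷ [])) (sym (+-identityʳ i))
wmajFrom-∷ʳ i (x ∷ [])    p r =
  cong₂ _+_ (sym (+-identityʳ (if ⌊ p ≤? x ⌋ then i else 0)))
            (cong (λ j → wmajFrom j (p ∷ r ∷ [])) (+-comm 1 i))
wmajFrom-∷ʳ i (x ∷ y ∷ ρ) p r = begin
  descentᵢ + wmajFrom (suc i) (y ∷ ρ ∷ʳ p ∷ʳ r)
    ≡⟨ cong (λ t → descentᵢ + t) (wmajFrom-∷ʳ (suc i) (y ∷ ρ) p r) ⟩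
  descentᵢ + (wmajFrom (suc i) (y ∷ ρ ∷ʳ p) + wmajFrom (suc i + length (y ∷ ρ)) (p ∷ r ∷ []))
    ≡⟨ sym (+-assoc descentᵢ _ _) ⟩
  descentᵢ + wmajFrom (suc i) (y ∷ ρ ∷ʳ p) + wmajFrom (suc i + length (y ∷ ρ)) (p ∷ r ∷ [])
    ≡⟨ cong (λ j → descentᵢ + wmajFrom (suc i) (y ∷ ρ ∷ʳ p) + wmajFrom j (p ∷ r ∷ []))
            (sym (+-suc i (length (y ∷ ρ)))) ⟩
  descentᵢ + wmajFrom (suc i) (y ∷ ρ ∷ʳ p) + wmajFrom (i + length (x ∷ y ∷ ρ)) (p ∷ r ∷ []) ∎
  where
  open ≡-Reasoning
  descentᵢ = if ⌊ y ≤? x ⌋ then i else 0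

dEntry-≰ : ∀ {p g r g′} → ¬ r ≤ p → dEntry p g r g′ ≡ 1
dEntry-≰ {p} {r = r} r≰p with r ≤? p
... | yes r≤p = contradiction r≤p r≰p
... | no _    = refl

dEntry-≢ : ∀ {p g r g′} → g′ ≢ suc g → dEntry p g r g′ ≡ 1
dEntry-≢ {p} {g} {r} {g′} g′≢1+g with r ≤? p | g′ ≟ suc g
... | _     | yes g′≡1+g = contradiction g′≡1+g g′≢1+g
... | yes _ | no _       = refl
... | no _  | no _       = refl

dEntry-≤ : ∀ {p g r} → r ≤ p → dEntry p g r (suc g) ≡ 0
dEntry-≤ {p} {g} {r} r≤p with r ≤? p | suc g ≟ suc g
... | no r≰p | _          = contradiction r≤p r≰p
... | yes _  | no 1+g≢1+g = contradiction refl 1+g≢1+g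
... | yes _  | yes _      = refl

wmajFrom-≰ : ∀ {i p r} → ¬ r ≤ p → wmajFrom i (p ∷ r ∷ []) ≡ 0
wmajFrom-≰ {p = p} {r} r≰p with r ≤? p
... | yes r≤p = contradiction r≤p r≰p
... | no _    = refl

wmajFrom-≤ : ∀ {i p r} → r ≤ p → wmajFrom i (p ∷ r ∷ []) ≡ i
wmajFrom-≤ {i} {p} {r} r≤p with r ≤? p
... | no r≰p = contradiction r≤p r≰p
... | yes _  = +-identityʳ i

shiftedExp : List ℕ → ℕ → List ℕ → ℕ
shiftedExp ρ b γ = dExp ρ (γ ∷ʳ suc b) + wmaj ρ + length ρ

shiftedExp-∷ʳ : ∀ {n} ρ γ p r b c → length ρ ≡ n → length γ ≡ n →
  shiftedExp (ρ ∷ʳ p ∷ʳ r) b (γ ∷ʳ suc c)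
    ≡ shiftedExp (ρ ∷ʳ p) c γ + (dEntry p (suc c) r (suc b) * b + wmajFrom (suc n) (p ∷ r ∷ []) + 1)
shiftedExp-∷ʳ ρ γ p r b c refl |γ|≡|ρ| =
  trans (cong₂ _+_ (cong₂ _+_ (dExp-∷ʳ ρ γ (sym |γ|≡|ρ|)) (wmajFrom-∷ʳ 1 ρ p r)) (length-∷ʳ (ρ ∷ʳ p) r))
        (regroup (dExp (ρ ∷ʳ p) (γ ∷ʳ suc c)) _ (wmaj (ρ ∷ʳ p)) _ (length (ρ ∷ʳ p)))
  where
  regroup : ∀ d e w x l → d + e + (w + x) + suc l ≡ d + w + l + (e + x + 1)
  regroup = solve-∀

module _ {n} (ρ : List ℕ) (p r : ℕ) (|ρ|≡n : length ρ ≡ n)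
         (ih : ∀ c → map (shiftedExp (ρ ∷ʳ p) c) (incSeqs n c) ↭ subsetSums n c (suc c)) where

  private
    block : ∀ c b K {d w} → dEntry p (suc c) r (suc b) ≡ d → wmajFrom (suc n) (p ∷ r ∷ []) ≡ w →
      d * b + w + 1 ≡ K →
      map (λ γ → shiftedExp (ρ ∷ʳ p ∷ʳ r) b (γ ∷ʳ suc c)) (incSeqs n c) ↭ subsetSums n c (suc c + K)
    block c b K dEntry≡d wmajFrom≡w increment≡K = begin
      map (λ γ → shiftedExp (ρ ∷ʳ p ∷ʳ r) b (γ ∷ʳ suc c)) (incSeqs n c)
        ≡⟨ map-cong-local (All.map (step _) (incSeqs-length n c)) ⟩
      map ((_+ K) ∘ shiftedExp (ρ ∷ʳ p) c) (incSeqs n c)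
        ≡⟨ map-∘ (incSeqs n c) ⟩
      map (_+ K) (map (shiftedExp (ρ ∷ʳ p) c) (incSeqs n c))
        ↭⟨ map⁺ (_+ K) (ih c) ⟩
      map (_+ K) (subsetSums n c (suc c))
        ≡⟨ sym (map-∘ (incSeqs n c)) ⟩
      map (λ γ → sum γ + suc c + K) (incSeqs n c)
        ≡⟨ map-cong (λ γ → +-assoc (sum γ) (suc c) K) (incSeqs n c) ⟩
      subsetSums n c (suc c + K) ∎
      where
      open PermutationReasoning
      step : ∀ γ → length γ ≡ n →
        shiftedExp (ρ ∷ʳ p ∷ʳ r) b (γ ∷ʳ suc c) ≡ shiftedExp (ρ ∷ʳ p) c γ + K
      step γ |γ|≡n = trans (shiftedExp-∷ʳ ρ γ p r b c |ρ|≡n |γ|≡n)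
        (cong (λ t → shiftedExp (ρ ∷ʳ p) c γ + t)
              (trans (cong₂ (λ d w → d * b + w + 1) dEntry≡d wmajFrom≡w) increment≡K))

  shiftedExp-∷ʳ-↭ : ∀ b →
    map (shiftedExp (ρ ∷ʳ p ∷ʳ r) b) (incSeqs (suc n) b) ↭ subsetSums (suc n) b (suc b)
  shiftedExp-∷ʳ-↭ b with r ≤? p
  ... | no r≰p = subsetSums-blocks {n} {b} _ λ c _ →
    block c b (suc b) (dEntry-≰ r≰p) (wmajFrom-≰ r≰p) (ascent b)
    where
    ascent : ∀ b → 1 * b + 0 + 1 ≡ suc b
    ascent = solve-∀
  ... | yes r≤p = descent b
    where
    descent : ∀ b → map (shiftedExp (ρ ∷ʳ p ∷ʳ r) b) (incSeqs (suc n) b) ↭ subsetSums (suc n) b (suc b)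
    descent zero    = ↭-refl
    descent (suc b) = begin
      map (shiftedExp (ρ ∷ʳ p ∷ʳ r) (suc b)) (incSeqs (suc n) (suc b))
        ≡⟨ map-incSeqs-suc _ n b ⟩
      map (shiftedExp (ρ ∷ʳ p ∷ʳ r) (suc b)) (incSeqs (suc n) b)
        ++ map (λ γ → shiftedExp (ρ ∷ʳ p ∷ʳ r) (suc b) (γ ∷ʳ suc b)) (incSeqs n b)
        ↭⟨ ++⁺ (subsetSums-blocks {n} {b} _ λ c c<b →
                  block c (suc b) _ (dEntry-≢ (>⇒≢ (s≤s (s≤s c<b)))) (wmajFrom-≤ r≤p) (gap b n))
               (block b (suc b) (suc (suc n)) (dEntry-≤ r≤p) (wmajFrom-≤ r≤p) (adjacent b n)) ⟩
      subsetSums (suc n) b (suc n + suc (suc b)) ++ subsetSums n b (suc b + suc (suc n))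
        ≡⟨ cong (λ a → subsetSums (suc n) b (suc n + suc (suc b)) ++ subsetSums n b a) (offset b n) ⟩
      subsetSums (suc n) b (suc n + suc (suc b)) ++ subsetSums n b (suc n + suc (suc b))
        ↭⟨ ↭-sym (subsetSums-pascal n b (suc (suc b))) ⟩
      subsetSums (suc n) (suc b) (suc (suc b)) ∎
      where
      open PermutationReasoning
      gap : ∀ b n → 1 * suc b + suc n + 1 ≡ suc n + suc (suc b)
      gap = solve-∀
      adjacent : ∀ b n → 0 * suc b + suc n + 1 ≡ suc (suc n)
      adjacent = solve-∀
      offset : ∀ b n → suc b + suc (suc n) ≡ suc n + suc (suc b)
      offset = solve-∀

shiftedExp-↭ : ∀ n ρ → length ρ ≡ suc n →
  ∀ b → map (shiftedExp ρ b) (incSeqs n b) ↭ subsetSums n b (suc b)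
shiftedExp-↭ zero (r ∷ []) refl b = ↭-reflexive (cong [_] (singleton b))
  where
  singleton : ∀ b → b + 0 + 0 + 1 ≡ suc b
  singleton = solve-∀
shiftedExp-↭ (suc n) ρ |ρ|≡2+n b with initLast ρ
... | ρ′ ∷ʳ′ r with initLast ρ′
...   | ρ″ ∷ʳ′ p =
  shiftedExp-∷ʳ-↭ ρ″ p r (length-init ρ″ |ρ′|≡1+n) (shiftedExp-↭ n (ρ″ ∷ʳ p) |ρ′|≡1+n) b
  where
  |ρ′|≡1+n = length-init (ρ″ ∷ʳ p) |ρ|≡2+n

dExp-↭ : ∀ {n} ρ → length ρ ≡ suc n → ∀ b →
  map (λ γ → + dExp ρ (γ ∷ʳ suc b)) (incSeqs n b)
    ↭ map (λ γ → (+ sum (γ ∷ʳ suc b) - + length ρ) - + wmaj ρ) (incSeqs n b)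
dExp-↭ {n} ρ |ρ|≡1+n b = begin
  map (λ γ → + dExp ρ (γ ∷ʳ suc b)) (incSeqs n b)
    ≡⟨ map-cong (λ γ → sym (cancel (dExp ρ (γ ∷ʳ suc b)))) (incSeqs n b) ⟩
  map (unshift ∘ shiftedExp ρ b) (incSeqs n b)
    ≡⟨ map-∘ (incSeqs n b) ⟩
  map unshift (map (shiftedExp ρ b) (incSeqs n b))
    ↭⟨ map⁺ unshift (shiftedExp-↭ n ρ |ρ|≡1+n b) ⟩
  map unshift (subsetSums n b (suc b))
    ≡⟨ sym (map-∘ (incSeqs n b)) ⟩
  map (λ γ → unshift (sum γ + suc b)) (incSeqs n b)
    ≡⟨ map-cong (λ γ → cong unshift (sym (sum-∷ʳ γ (suc b)))) (incSeqs n b) ⟩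
  map (λ γ → unshift (sum (γ ∷ʳ suc b))) (incSeqs n b) ∎
  where
  open PermutationReasoning
  unshift : ℕ → ℤ
  unshift t = (+ t - + length ρ) - + wmaj ρ
  cancel : ∀ d → unshift (d + wmaj ρ + length ρ) ≡ + d
  cancel d = trans (cong (_- + wmaj ρ) (+[m+n]-+n≡+m (d + wmaj ρ) (length ρ))) (+[m+n]-+n≡+m d (wmaj ρ))

lemma4p3 : (s : ℕ) → 1 ≤ s → (ρ : List ℕ) → 1 ≤ length ρ →
    All (λ r → 1 ≤ r × r ≤ s ∸ 1) ρ → (γm : ℕ) → 1 ≤ γm →
    map (λ γ → + dExp ρ (γ ∷ʳ γm)) (incSeqs (length ρ ∸ 1) (γm ∸ 1))
      ↭ map (λ γ → (+ sum (γ ∷ʳ γm) - + length ρ) - + wmaj ρ) (incSeqs (length ρ ∸ 1) (γm ∸ 1))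
-- The bounds on s and on the entries of ρ are not needed.
lemma4p3 _ _ (r ∷ ρ) _ _ (suc b) _ = dExp-↭ (r ∷ ρ) refl b
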